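{- Let $P$ be a logic program over $\Sigma$ and $t\in\mathbf{Term}(\Sigma)$. If there is an S-refutation $T_0=\mathrm{rew}(P,?\gets t,\mathit{id})\to T_1\to\cdots\to T_n$ with associated external resolvents $\sigma_1,\ldots,\sigma_n$, then for every grounding substitution $\theta\in\mathbf{Subst}(\Sigma)$ for $\sigma_n\cdots\sigma_1(t)$ we have $\theta\sigma_n\cdots\sigma_1(t)\in M_P$.
   Context: Terms are finite first-order terms with variables over a signature $\Sigma$ containing at least one constant; $\mathbf{Subst}(\Sigma)$ denotes substitutions with finite-term codomain; $\theta$ is grounding for $u$ if $\theta(u)$ has no variables. A clause is $A\gets B_0,\ldots,B_m$ (body possibly empty); a goal clause is $?\gets B_0,\ldots,B_m$; a logic program $P$ is a finite list $P(0),\ldots,P(k)$ of non-goal clauses, viewed as functions on $\{\epsilon,0,\ldots,m\}$ ($C(\epsilon)$ the head). $s\prec_\theta u$: $\theta$ is a most general matcher of $s$ against $u$; $s\sim_\theta u$: $\theta$ is a most general unifier. Clause variables are renamed apart. $M_P$ is the least set of finite ground terms such that for each clause $A\gets B_1,\ldots,B_n$ of $P$ and grounding $\sigma$, $\sigma(B_1),\ldots,\sigma(B_n)\in M_P$ implies $\sigma(A)\in M_P$. Rewriting tree $T=\mathrm{rew}(P,C,\sigma)$ ($\sigma$ idempotent; $V_R$ a set of or-node variables): $T(\epsilon)=\sigma(C)$, $T(i)=\sigma(C(i))$ for body positions $i$ of $C$; each odd-length node $w$ is a term with, for every clause index $i$, a child $wi$ labelled $\sigma(\theta(P(i)))$ if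 $\mathrm{head}(P(i))\prec_\theta T(w)$, else a fresh variable of $V_R$; even positive-length nodes are clauses or variables; variables are leaves; a clause node $\sigma(\theta(P(i)))$ at $w$ has children $wj$ labelled $\sigma(\theta(P(i)(j)))$ for body positions $j$. A rewriting subtree contains the root, all children of its even-depth nodes, exactly one child of each of its odd-depth nodes. An inductive success tree has a finite rewriting subtree whose leaves are all non-variable leaf or-nodes. Tree transition: if $T=\mathrm{rew}(P,C,\sigma)$ and $X=T(wi)\in V_R$, the external resolvent is $\theta$ with $\mathrm{head}(P(i))\sim_\theta T(w)$; $T_X$ is empty if none exists, else $T_X=\mathrm{rew}(P,C,\theta\sigma)$. An S-refutation is a finite sequence $T_0=\mathrm{rew}(P,?\gets t,\mathit{id})\to\cdots\to T_n$ of tree transitions with $T_n$ an inductive success tree. -}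

module Defs where

open import Data.Nat using (ℕ; zero; suc; _≤_)
open import Data.Bool using (Bool; true; false)
open import Data.Fin using (Fin; toℕ)
open import Data.Vec using (Vec; []; _∷_)
open import Data.List using (List; []; _∷_; length; map; lookup)
open import Data.List.Relation.Unary.All using (All)
open import Data.List.Membership.Propositional using (_∈_)
open import Data.Maybe using (Maybe; just; nothing)
import Data.Maybe as Maybe
open import Data.Product using (_×_; ∃; ∃-syntax; _,_)
open import Data.Sum using (_⊎_)
open import Relation.Binary.PropositionalEquality using (_≡_)
open import Relation.Nullary using (¬_)
open import Function.Definitions using (Injective)

record Signature : Set₁ where
  field
    Sym       : Set
    arity     : Sym → ℕ
    const     : Sym
    const-ar  : arity const ≡ 0

module _ (Sig : Signature) where
  open Signature Sig

  data Term : Set where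
    var : ℕ → Term
    fn  : (f : Sym) → Vec Term (arity f) → Term

  Subst : Set
  Subst = ℕ → Term

  record Clause : Set where
    constructor _⇐_
    field
      head : Term
      body : List Term

  -- general clauses (head may be '?', i.e. a goal clause)
  record GClause : Set where
    constructor _⇐?_
    field
      ghead : Maybe Term
      gbody : List Term

  Program : Set
  Program = List Clause

open Clause public
open GClause public

module _ {Sig : Signature} where
  open Signature Sig

  mutual
    apply : Subst Sig → Term Sig → Term Sig
    apply σ (var x)  = σ x
    apply σ (fn f ts) = fn f (applyV σ ts)

    applyV : ∀ {n} → Subst Sig → Vec (Term Sig) n → Vec (Term Sig) n
    applyV σ []       = []
    applyV σ (t ∷ ts) = apply σ t ∷ applyV σ ts

  idS : Subst Sig
  idS = var

  _∘ₛ_ : Subst Sig → Subst Sig → Subst Sig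
  (θ ∘ₛ σ) x = apply θ (σ x)

  Idempotent : Subst Sig → Set
  Idempotent σ = ∀ x → apply σ (σ x) ≡ σ x

  -- σₙ ⋯ σ₁ (t)  for the list  σ₁ ∷ … ∷ σₙ ∷ []
  applyAll : List (Subst Sig) → Term Sig → Term Sig
  applyAll []       t = t
  applyAll (σ ∷ σs) t = applyAll σs (apply σ t)

  mutual
    data _occursIn_ : ℕ → Term Sig → Set where
      here : ∀ {x} → x occursIn var x
      arg  : ∀ {x f ts} → x occursInV ts → x occursIn fn f ts

    data _occursInV_ : ∀ {n} → ℕ → Vec (Term Sig) n → Set where
      hd : ∀ {x n t} {ts : Vec (Term Sig) n} → x occursIn t → x occursInV (t ∷ ts)
      tl : ∀ {x n t} {ts : Vec (Term Sig) n} → x occursInV ts → x occursInV (t ∷ ts)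

  Ground : Term Sig → Set
  Ground t = ∀ x → ¬ (x occursIn t)

  Grounding : Subst Sig → Term Sig → Set
  Grounding θ u = Ground (apply θ u)

  Matcher : Subst Sig → Term Sig → Term Sig → Set
  Matcher θ s u = apply θ s ≡ u

  MGM : Subst Sig → Term Sig → Term Sig → Set
  MGM θ s u = Matcher θ s u ×
    (∀ θ′ → Matcher θ′ s u → ∃[ γ ] (∀ x → apply γ (θ x) ≡ θ′ x))

  Unifier : Subst Sig → Term Sig → Term Sig → Set
  Unifier θ s u = apply θ s ≡ apply θ u

  MGU : Subst Sig → Term Sig → Term Sig → Set
  MGU θ s u = Unifier θ s u ×
    (∀ θ′ → Unifier θ′ s u → ∃[ γ ] (∀ x → apply γ (θ x) ≡ θ′ x))

  applyC : Subst Sig → Clause Sig → Clause Sig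
  applyC σ (A ⇐ Bs) = apply σ A ⇐ map (apply σ) Bs

  -- The least Herbrand model M_P

  data M (P : Program Sig) : Term Sig → Set where
    mk : (i : Fin (length P)) (σ : Subst Sig) →
         Ground (apply σ (head (lookup P i))) →
         All (λ B → Ground (apply σ B)) (body (lookup P i)) →
         All (λ B → M P (apply σ B)) (body (lookup P i)) →
         M P (apply σ (head (lookup P i)))

  -- Rewriting trees, as partial labellings of positions.
  -- A position is a list of child indices stored in REVERSE order:
  -- the child  w·i  of the position  w  is  i ∷ w ; the root is [].

  Position : Set
  Position = List ℕ

  data Label : Set where
    termL   : Term Sig → Label                       -- and-node (term)
    clauseL : Maybe (Term Sig) → List (Term Sig) → Label   -- or-node clause / root
    orVar   : Label                                  -- a fresh variable of V_R

  Tree : Set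
  Tree = Position → Maybe Label

  ClauseNodeAt : Tree → Subst Sig → Subst Sig → Clause Sig → Position → Set
  ClauseNodeAt T σ θ c v =
    (T v ≡ just (clauseL (just (apply σ (apply θ (head c))))
                         (map (λ B → apply σ (apply θ B)) (body c)))) ×
    (∀ (j : Fin (length (body c))) →
        T (toℕ j ∷ v) ≡ just (termL (apply σ (apply θ (lookup (body c) j))))) ×
    (∀ j → length (body c) ≤ j → T (j ∷ v) ≡ nothing)

  record IsRew (P : Program Sig) (C : GClause Sig) (σ : Subst Sig) (T : Tree) : Set where
    field
      idem       : Idempotent σ
      root       : T [] ≡ just (clauseL (Maybe.map (apply σ) (ghead C))
                                        (map (apply σ) (gbody C)))
      rootKids   : ∀ (j : Fin (length (gbody C))) →
                     T (toℕ j ∷ []) ≡ just (termL (apply σ (lookup (gbody C) j)))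
      rootNoKids : ∀ j → length (gbody C) ≤ j → T (j ∷ []) ≡ nothing
      andKids    : ∀ w u → T w ≡ just (termL u) → ∀ (i : Fin (length P)) →
                     (∃[ θ ] (MGM θ (head (lookup P i)) u ×
                              ClauseNodeAt T σ θ (lookup P i) (toℕ i ∷ w)))
                     ⊎ ((∀ θ → ¬ MGM θ (head (lookup P i)) u) ×
                        T (toℕ i ∷ w) ≡ just orVar)
      andNoKids  : ∀ w u → T w ≡ just (termL u) → ∀ i → length P ≤ i →
                     T (i ∷ w) ≡ nothing
      orVarLeaf  : ∀ w → T w ≡ just orVar → ∀ j → T (j ∷ w) ≡ nothing
      undefLeaf  : ∀ w → T w ≡ nothing → ∀ j → T (j ∷ w) ≡ nothing

  isEven : ℕ → Bool
  isEven zero          = true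
  isEven (suc zero)    = false
  isEven (suc (suc n)) = isEven n

  IsNode : Tree → Position → Set
  IsNode T w = ∃[ l ] (T w ≡ just l)

  record RewritingSubtree (T : Tree) (S : List Position) : Set where
    field
      rootIn     : [] ∈ S
      nodesIn    : ∀ w → w ∈ S → IsNode T w
      parentIn   : ∀ i w → (i ∷ w) ∈ S → w ∈ S
      evenAll    : ∀ w → w ∈ S → isEven (length w) ≡ true →
                     ∀ j → IsNode T (j ∷ w) → (j ∷ w) ∈ S
      oddOne     : ∀ w → w ∈ S → isEven (length w) ≡ false →
                     ∃[ i ] (((i ∷ w) ∈ S) × (∀ i′ → (i′ ∷ w) ∈ S → i′ ≡ i))

  NonVarLeafOrNode : Tree → Position → Set
  NonVarLeafOrNode T w =
    (∃[ h ] ∃[ bs ] (T w ≡ just (clauseL h bs))) × (∀ j → T (j ∷ w) ≡ nothing)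

  InductiveSuccess : Tree → Set
  InductiveSuccess T = ∃[ S ] (RewritingSubtree T S ×
    (∀ w → w ∈ S → (∀ j → ¬ ((j ∷ w) ∈ S)) → NonVarLeafOrNode T w))

  FreshRenaming : (ℕ → ℕ) → Term Sig → Set
  FreshRenaming ρ u = Injective _≡_ _≡_ ρ × (∀ x → ¬ (ρ x occursIn u))

  Transition : Program Sig → GClause Sig → Subst Sig → Tree → Subst Sig → Tree → Set
  Transition P C σ T θ T′ =
    ∃[ w ] ∃[ i ] ∃[ u ]
      ((T w ≡ just (termL u)) ×
       (T (toℕ i ∷ w) ≡ just orVar) ×
       (∃[ ρ ] (FreshRenaming ρ u ×
                MGU θ (apply (λ x → var (ρ x)) (head (lookup P i))) u)) ×
       IsRew P C (θ ∘ₛ σ) T′)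

  data Steps (P : Program Sig) (C : GClause Sig) :
       Subst Sig → Tree → List (Subst Sig) → Tree → Set where
    done : ∀ {σ T} → Steps P C σ T [] T
    step : ∀ {σ T θ T′ θs T″} → Transition P C σ T θ T′ →
           Steps P C (θ ∘ₛ σ) T′ θs T″ → Steps P C σ T (θ ∷ θs) T″

  goal : Term Sig → GClause Sig
  goal t = nothing ⇐? (t ∷ [])

  SRefutation : Program Sig → Term Sig → List (Subst Sig) → Set
  SRefutation P t σs = ∃[ T₀ ] ∃[ Tₙ ]
    (IsRew P (goal t) idS T₀ × Steps P (goal t) idS T₀ σs Tₙ × InductiveSuccess Tₙ)

module Submission where

--  * Transitions only change the substitution of a rewriting tree: a chain
--    of transitions from rew(P,C,σ) ends in rew(P,C,σ′) with
--    σ′(s) = σₙ⋯σ₁(σ(s))  (lemma rew-after-steps).  Starting from id, the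
--    final tree is rew(P, ?← t, σ′) with σ′(t) = σₙ⋯σ₁(t).
--
--  * Every inductive success tree rew(P,C,σ) is sound (module Success):
--    each term node u of its finite rewriting subtree S has all ground
--    instances in M_P.  The subtree selects a clause node σ(θ(c)) below u,
--    with θ matching head(c) to u; its body atoms are again term nodes of
--    S, and a ground instance of u is the head of a ground instance of c.
--    The induction runs on the distance to the maximal depth of S.  Body
--    variables not bound by the head are sent to a fixed constant, which
--    is where the assumption that Σ has a constant is used.

open import Defs
open import Data.Nat using (ℕ; zero; suc; _≤_; _<_; _+_; _<?_)
open import Data.Nat.Properties
  using (≤-trans; ≤-reflexive; n≤1+n; +-suc; +-identityʳ; <⇒≱; ≮⇒≥)
open import Data.Fin using (Fin; toℕ; fromℕ<) renaming (zero to fzero)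
open import Data.Fin.Properties using (toℕ-fromℕ<)
open import Data.Vec using (Vec; []; _∷_)
open import Data.List using (List; []; _∷_; length; lookup; map)
open import Data.List.Extrema.Nat using (max; xs≤max)
open import Data.List.Relation.Unary.All as All using (All)
open import Data.List.Relation.Unary.Any using (index)
open import Data.List.Relation.Unary.Any.Properties using (lookup-index)
open import Data.List.Membership.Propositional using (_∈_)
open import Data.List.Membership.Propositional.Properties using (∈-map⁺)
open import Data.Bool using (true; false)
open import Data.Maybe using (just; nothing)
open import Data.Product using (_×_; ∃-syntax; _,_; proj₂)
open import Data.Sum using (inj₁; inj₂)
open import Data.Empty using (⊥-elim)
open import Relation.Nullary using (¬_; yes; no)
open import Relation.Binary.PropositionalEquality

module _ {Sig : Signature} where
  open Signature Sig

  mutual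
    apply-id : (t : Term Sig) → apply idS t ≡ t
    apply-id (var x)   = refl
    apply-id (fn f ts) = cong (fn f) (applyV-id ts)

    applyV-id : ∀ {n} (ts : Vec (Term Sig) n) → applyV idS ts ≡ ts
    applyV-id []       = refl
    applyV-id (t ∷ ts) = cong₂ _∷_ (apply-id t) (applyV-id ts)

  mutual
    apply-∘ : (θ σ : Subst Sig) (t : Term Sig) →
              apply (θ ∘ₛ σ) t ≡ apply θ (apply σ t)
    apply-∘ θ σ (var x)   = refl
    apply-∘ θ σ (fn f ts) = cong (fn f) (applyV-∘ θ σ ts)

    applyV-∘ : ∀ {n} (θ σ : Subst Sig) (ts : Vec (Term Sig) n) →
               applyV (θ ∘ₛ σ) ts ≡ applyV θ (applyV σ ts)
    applyV-∘ θ σ []       = refl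
    applyV-∘ θ σ (t ∷ ts) = cong₂ _∷_ (apply-∘ θ σ t) (applyV-∘ θ σ ts)

  mutual
    apply-idem : (σ : Subst Sig) → Idempotent σ → (t : Term Sig) →
                 apply σ (apply σ t) ≡ apply σ t
    apply-idem σ idem (var x)   = idem x
    apply-idem σ idem (fn f ts) = cong (fn f) (applyV-idem σ idem ts)

    applyV-idem : ∀ {n} (σ : Subst Sig) → Idempotent σ → (ts : Vec (Term Sig) n) →
                  applyV σ (applyV σ ts) ≡ applyV σ ts
    applyV-idem σ idem []       = refl
    applyV-idem σ idem (t ∷ ts) = cong₂ _∷_ (apply-idem σ idem t) (applyV-idem σ idem ts)

  mutual
    apply-ground : (γ : Subst Sig) (t : Term Sig) → Ground t → apply γ t ≡ t
    apply-ground γ (var x)   g = ⊥-elim (g x here)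
    apply-ground γ (fn f ts) g = cong (fn f) (applyV-ground γ ts (λ x p → g x (arg p)))

    applyV-ground : ∀ {n} (γ : Subst Sig) (ts : Vec (Term Sig) n) →
                    (∀ x → ¬ (x occursInV ts)) → applyV γ ts ≡ ts
    applyV-ground γ []       g = refl
    applyV-ground γ (t ∷ ts) g =
      cong₂ _∷_ (apply-ground γ t (λ x p → g x (hd p)))
                (applyV-ground γ ts (λ x p → g x (tl p)))

  constTerm : Term Sig
  constTerm = fn const (subst (Vec (Term Sig)) (sym const-ar) [])

  constTerm-ground : Ground constTerm
  constTerm-ground x (arg p) = no-occurrence _ const-ar p
    where
      no-occurrence : ∀ {n} (ts : Vec (Term Sig) n) → n ≡ 0 → ¬ (x occursInV ts)
      no-occurrence (_ ∷ _) () _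

  close : Subst Sig
  close _ = constTerm

  mutual
    close-ground : (t : Term Sig) → Ground (apply close t)
    close-ground (var y)   = constTerm-ground
    close-ground (fn f ts) x (arg p) = closeV-ground ts x p

    closeV-ground : ∀ {n} (ts : Vec (Term Sig) n) → ∀ x → ¬ (x occursInV applyV close ts)
    closeV-ground (t ∷ ts) x (hd p) = close-ground t x p
    closeV-ground (t ∷ ts) x (tl p) = closeV-ground ts x p

  close∘-ground : (γ : Subst Sig) (t : Term Sig) → Ground (apply (close ∘ₛ γ) t)
  close∘-ground γ t = subst Ground (sym (apply-∘ close γ t)) (close-ground (apply γ t))

  -- The body variables that do not
  -- occur in the head are instantiated by the constant.
  clause-instance : (P : Program Sig) (i : Fin (length P)) (ρ : Subst Sig) →
    let c = lookup P i in
    Ground (apply ρ (head c)) →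
    All (λ B → M P (apply (close ∘ₛ ρ) B)) (body c) →
    M P (apply ρ (head c))
  clause-instance P i ρ ground-head body-in-M =
    subst (M P) closed-head
      (mk i (close ∘ₛ ρ)
          (subst Ground (sym closed-head) ground-head)
          (All.universal (close∘-ground ρ) (body c))
          body-in-M)
    where
      c = lookup P i
      closed-head : apply (close ∘ₛ ρ) (head c) ≡ apply ρ (head c)
      closed-head = trans (apply-∘ close ρ (head c))
                          (apply-ground close _ ground-head)

  all-by-index : {Q : Term Sig → Set} (xs : List (Term Sig)) →
                 (∀ (j : Fin (length xs)) → Q (lookup xs j)) → All Q xs
  all-by-index {Q} xs f =
    All.tabulate (λ x∈xs → subst Q (sym (lookup-index x∈xs)) (f (index x∈xs)))

  rew-after-steps : ∀ {P C σ T θs T′} → Steps P C σ T θs T′ → IsRew P C σ T →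
    ∃[ σ′ ] (IsRew P C σ′ T′ × (∀ s → apply σ′ s ≡ applyAll θs (apply σ s)))
  rew-after-steps {σ = σ} done rew = σ , rew , λ s → refl
  rew-after-steps (step {θ = θ} {θs = θs} (_ , _ , _ , _ , _ , _ , rew′) steps) _
    with rew-after-steps steps rew′
  ... | σ′ , rew″ , σ′-eq =
    σ′ , rew″ , λ s → trans (σ′-eq s) (cong (applyAll θs) (apply-∘ θ _ s))

  isEven-suc : ∀ l → isEven {Sig} l ≡ false → isEven {Sig} (suc l) ≡ true
  isEven-suc (suc zero)    _ = refl
  isEven-suc (suc (suc l)) e = isEven-suc l e

  just≢nothing : ∀ {A : Set} {a : A} → just a ≢ nothing
  just≢nothing ()

  module Success (P : Program Sig) (C : GClause Sig) (σ : Subst Sig) (T : Tree {Sig})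
                 (rew : IsRew P C σ T) (S : List (Position {Sig}))
                 (subtree : RewritingSubtree T S)
                 (leaves : ∀ w → w ∈ S → (∀ j → ¬ ((j ∷ w) ∈ S)) → NonVarLeafOrNode T w)
                 where
    open IsRew rew
    open RewritingSubtree subtree

    depth : ℕ
    depth = max 0 (map length S)

    depth-bound : ∀ {w} → w ∈ S → length w ≤ depth
    depth-bound w∈S = All.lookup (xs≤max 0 (map length S)) (∈-map⁺ length w∈S)

    -- A variable or-node of T has no children, so it cannot lie in S: it
    -- would be a leaf of S, and leaves of S are clause nodes.
    orVar∉S : ∀ w → w ∈ S → ¬ (T w ≡ just orVar)
    orVar∉S w w∈S Tw≡orVar with leaves w w∈S no-child
      where
        no-child : ∀ j → ¬ ((j ∷ w) ∈ S)
        no-child j jw∈S = just≢nothing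
          (trans (sym (proj₂ (nodesIn _ jw∈S))) (orVarLeaf w Tw≡orVar j))
    ... | (_ , _ , Tw≡clause) , _ with trans (sym Tw≡orVar) Tw≡clause
    ... | ()

    selected-index : ∀ w u → w ∈ S → isEven {Sig} (length w) ≡ false → T w ≡ just (termL u) →
                     ∃[ i ] ((toℕ {length P} i ∷ w) ∈ S)
    selected-index w u w∈S odd Tw with oddOne w w∈S odd
    ... | k , kw∈S , _ with k <? length P
    ... | yes k<|P| = fromℕ< k<|P| , subst (λ n → (n ∷ w) ∈ S) (sym (toℕ-fromℕ< k<|P|)) kw∈S
    ... | no  k≮|P| = ⊥-elim (just≢nothing
            (trans (sym (proj₂ (nodesIn _ kw∈S))) (andNoKids w u Tw k (≮⇒≥ k≮|P|))))

    selected-clause : ∀ w u → w ∈ S → isEven {Sig} (length w) ≡ false → T w ≡ just (termL u) →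
      ∃[ i ] ∃[ θ ] (apply θ (head (lookup P i)) ≡ u ×
                     ClauseNodeAt T σ θ (lookup P i) (toℕ i ∷ w) ×
                     (toℕ i ∷ w) ∈ S)
    selected-clause w u w∈S odd Tw with selected-index w u w∈S odd Tw
    ... | i , iw∈S with andKids w u Tw i
    ... | inj₁ (θ , (matches , _) , clause-node) = i , θ , matches , clause-node , iw∈S
    ... | inj₂ (_ , Tiw≡orVar) = ⊥-elim (orVar∉S _ iw∈S Tiw≡orVar)

    term-node-sound : ∀ n w u → w ∈ S → isEven {Sig} (length w) ≡ false →
      depth < length w + n → T w ≡ just (termL u) → apply σ u ≡ u →
      ∀ γ → Ground (apply γ u) → M P (apply γ u)
    term-node-sound zero w u w∈S _ fuel _ _ _ _ =
      ⊥-elim (<⇒≱ (subst (depth <_) (+-identityʳ (length w)) fuel) (depth-bound w∈S))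
    term-node-sound (suc n) w u w∈S odd fuel Tw σ-fixed γ ground
      with selected-clause w u w∈S odd Tw
    ... | i , θ , matches , (_ , body-nodes , _) , iw∈S =
      subst (M P) head-instance
        (clause-instance P i ρ (subst Ground (sym head-instance) ground)
           (all-by-index (body c) body-sound))
      where
        c = lookup P i
        ρ = γ ∘ₛ (σ ∘ₛ θ)

        ρ-expand : ∀ B → apply ρ B ≡ apply γ (apply σ (apply θ B))
        ρ-expand B = trans (apply-∘ γ (σ ∘ₛ θ) B) (cong (apply γ) (apply-∘ σ θ B))

        head-instance : apply ρ (head c) ≡ apply γ u
        head-instance = begin
          apply ρ (head c)                      ≡⟨ ρ-expand (head c) ⟩
          apply γ (apply σ (apply θ (head c)))  ≡⟨ cong (λ s → apply γ (apply σ s)) matches ⟩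
          apply γ (apply σ u)                   ≡⟨ cong (apply γ) σ-fixed ⟩
          apply γ u                             ∎
          where open ≡-Reasoning

        -- each body atom σ(θ(B)) is a term node of S two levels down
        body-sound : ∀ j → M P (apply (close ∘ₛ ρ) (lookup (body c) j))
        body-sound j = subst (M P) closed-instance
            (term-node-sound n (toℕ j ∷ toℕ i ∷ w) Bσθ
               (evenAll _ iw∈S (isEven-suc (length w) odd) (toℕ j) (_ , body-nodes j))
               odd
               (≤-trans fuel (≤-trans (≤-reflexive (+-suc (length w) n)) (n≤1+n _)))
               (body-nodes j)
               (apply-idem σ idem (apply θ B))
               (close ∘ₛ γ) (close∘-ground γ Bσθ))
          where
            B = lookup (body c) j
            Bσθ = apply σ (apply θ B)
            closed-instance : apply (close ∘ₛ γ) Bσθ ≡ apply (close ∘ₛ ρ) B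
            closed-instance = begin
              apply (close ∘ₛ γ) Bσθ          ≡⟨ apply-∘ close γ Bσθ ⟩
              apply close (apply γ Bσθ)       ≡⟨ cong (apply close) (sym (ρ-expand B)) ⟩
              apply close (apply ρ B)         ≡⟨ sym (apply-∘ close ρ B) ⟩
              apply (close ∘ₛ ρ) B            ∎
              where open ≡-Reasoning

    root-atom-sound : ∀ (j : Fin (length (gbody C))) γ →
      let u = apply σ (lookup (gbody C) j) in
      Ground (apply γ u) → M P (apply γ u)
    root-atom-sound j γ =
      term-node-sound (suc depth) (toℕ j ∷ []) _
        (evenAll [] rootIn refl (toℕ j) (_ , rootKids j))
        refl (n≤1+n (suc depth)) (rootKids j)
        (apply-idem σ idem (lookup (gbody C) j)) γ

corollary3p16 : (Sig : Signature) (P : Program Sig) (t : Term Sig)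
    (σs : List (Subst Sig)) → SRefutation P t σs →
    (θ : Subst Sig) → Grounding θ (applyAll σs t) →
    M P (apply θ (applyAll σs t))
corollary3p16 Sig P t σs (T₀ , Tₙ , rew₀ , steps , (S , subtree , leaves)) θ ground
  with rew-after-steps steps rew₀
... | σ′ , rewₙ , σ′-eq =
  subst (λ s → M P (apply θ s)) σ′t≡
    (Success.root-atom-sound P (goal t) σ′ Tₙ rewₙ S subtree leaves fzero θ
       (subst (λ s → Ground (apply θ s)) (sym σ′t≡) ground))
  where
    σ′t≡ : apply σ′ t ≡ applyAll σs t
    σ′t≡ = trans (σ′-eq t) (cong (applyAll σs) (apply-id t))
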